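{- Let $n\ge2$ and $l<k$ be natural numbers and let $\mathcal{I}$ be an ideal on $\omega$. Then $\mathcal{R}^n_{k,l}\le_K\mathcal{I}$ if and only if $\omega\not\to(\mathcal{I}^+)^n_{k,l}$.
   Context: A function $R:[\omega]^n\to k$ has the $(n,k)$-star property if for every pairwise disjoint finite sets $A_0,\dots,A_{k-1}\subseteq[\omega]^{n-1}$ there exists $j\in\omega\setminus\bigcup_{i<k}\bigcup A_i$ such that $R(\{j,j_2,\dots,j_n\})=i$ whenever $\{j_2,\dots,j_n\}\in A_i$. Fix such a function $R^n_k:[\omega]^n\to k$ (the $n$-random graph with $k$ colors). $\mathcal{R}^n_{k,l}$ is the ideal on $\omega$ generated by $\{A\subseteq\omega: |R^n_k[[A]^n]|\le l\}$. For an ideal $\mathcal{I}$ on $\omega$, $\omega\to(\mathcal{I}^+)^n_{k,l}$ means: for every $c:[\omega]^n\to k$ there is $A\notin\mathcal{I}$ with $|c[[A]^n]|\le l$. $\mathcal{I}\le_K\mathcal{J}$ (Katětov) means there is $f:\omega\to\omega$ with $f^{ -1}[A]\in\mathcal{J}$ for every $A\in\mathcal{I}$. -}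

module Defs where

open import Level using (0ℓ)
open import Data.Bool using (Bool; true; false; if_then_else_)
open import Data.Nat using (ℕ; zero; suc; _<_; _≤_; _≤ᵇ_)
open import Data.Fin using (Fin)
open import Data.Fin.Subset using (_∈_; ∣_∣) renaming (Subset to ColourSet)
open import Data.Vec using (Vec; []; _∷_)
import Data.Vec.Relation.Unary.All as VAll
open import Data.List using (List)
open import Data.List.Relation.Unary.All using (All)
open import Data.List.Relation.Unary.Any using (Any)
import Data.List.Membership.Propositional as LMem
open import Data.Product using (Σ; _×_; proj₁; proj₂)
open import Data.Unit using (⊤)
open import Data.Empty using (⊥)
open import Relation.Nullary using (¬_)
open import Relation.Binary.PropositionalEquality using (_≡_)

Sub : Set
Sub = ℕ → Bool

_∈ω_ : ℕ → Sub → Set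
x ∈ω A = A x ≡ true

_⊆ω_ : Sub → Sub → Set
A ⊆ω B = ∀ x → x ∈ω A → x ∈ω B

_∪ω_ : Sub → Sub → Sub
(A ∪ω B) x = if A x then true else B x

ωset : Sub
ωset _ = true

Finite : Sub → Set
Finite A = Σ ℕ λ N → ∀ x → x ∈ω A → x < N

preimage : (ℕ → ℕ) → Sub → Sub
preimage f A x = A (f x)

record IsIdeal (I : Sub → Set) : Set where
  field
    downward : ∀ A B → A ⊆ω B → I B → I A
    union    : ∀ A B → I A → I B → I (A ∪ω B)
    finite   : ∀ A → Finite A → I A
    proper   : ¬ I ωset

_≤K_ : (Sub → Set) → (Sub → Set) → Set
I ≤K J = Σ (ℕ → ℕ) λ f → ∀ A → I A → J (preimage f A)

-- [ω]^n is represented by strictly increasing vectors of length n.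
-- A colouring [ω]^n → k is represented by a function Vec ℕ n → Fin k
-- whose values on non-increasing vectors are irrelevant (they are never
-- used below).

Incr : ∀ {n} → Vec ℕ n → Set
Incr [] = ⊤
Incr (x ∷ []) = ⊤
Incr (x ∷ y ∷ xs) = x < y × Incr (y ∷ xs)

InSq : ∀ {n} → Sub → Vec ℕ n → Set
InSq A s = Incr s × VAll.All (λ x → x ∈ω A) s

ImageAtMost : ∀ {n k} → (Vec ℕ n → Fin k) → Sub → ℕ → Set
ImageAtMost {n} {k} c A l =
  Σ (ColourSet k) λ S → ∣ S ∣ ≤ l × (∀ (s : Vec ℕ n) → InSq A s → c s ∈ S)

ins : ∀ {m} → ℕ → Vec ℕ m → Vec ℕ (suc m)
ins j [] = j ∷ []
ins j (x ∷ xs) = if j ≤ᵇ x then j ∷ x ∷ xs else x ∷ ins j xs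

-- The pairwise disjoint finite sets
-- A₀,…,A_{k-1} ⊆ [ω]^{n-1} are given by one finite list of pairs (t , i)
-- meaning t ∈ A_i; disjointness = no t occurs with two colours.
StarProperty : ∀ n k → (Vec ℕ n → Fin k) → Set
StarProperty zero k R = ⊤
StarProperty (suc m) k R =
  ∀ (L : List (Vec ℕ m × Fin k)) →
  All (λ p → Incr (proj₁ p)) L →
  (∀ p q → p LMem.∈ L → q LMem.∈ L → proj₁ p ≡ proj₁ q → proj₂ p ≡ proj₂ q) →
  Σ ℕ λ j →
    All (λ p → VAll.All (λ x → ¬ j ≡ x) (proj₁ p)) L ×
    All (λ p → R (ins j (proj₁ p)) ≡ proj₂ p) L

-- The ideal ℛ^n_{k,l} generated by {A : |R[[A]^n]| ≤ l}:
-- A is in it iff A is covered by finitely many generators.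
RIdeal : ∀ n k → ℕ → (Vec ℕ n → Fin k) → Sub → Set
RIdeal n k l R A =
  Σ (List Sub) λ Bs → All (λ B → ImageAtMost R B l) Bs ×
    (∀ x → x ∈ω A → Any (λ B → x ∈ω B) Bs)

Arrow : (Sub → Set) → ℕ → ℕ → ℕ → Set
Arrow I n k l =
  ∀ (c : Vec ℕ n → Fin k) → Σ Sub λ A → ¬ I A × ImageAtMost c A l

-- A Katětov reduction g of ℛ to 𝓘 pulls R back to the colouring
-- s ↦ R(g[s]); an 𝓘-positive set A with at most l colours would have
-- image g[A] ∈ ℛ, whence A ⊆ g⁻¹[g[A]] ∈ 𝓘.  Conversely, if some colouring
-- c has all its sets with at most l colours in 𝓘, the star property embeds
-- c into R: choose f(M) inductively so that R(f[t] ∪ {f(M)}) = c(t ∪ {M})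
-- for every (n−1)-set t ⊆ M, avoiding all earlier values.  Then
-- c(s) = R(f[s]), so the f-preimage of a set with at most l R-colours has
-- at most l c-colours and lies in 𝓘.
module Submission where

open import Defs
open import Level using (0ℓ)
open import Axiom.ExcludedMiddle using (ExcludedMiddle)
open import Data.Bool using (true; false; if_then_else_)
open import Data.Empty using (⊥-elim)
open import Data.Fin using (Fin)
open import Data.Fin.Subset using () renaming (_∈_ to _∈ₛ_)
open import Data.List using (List; []; _∷_; upTo; concatMap; filter) renaming (map to mapₗ)
open import Data.List.Membership.Propositional using () renaming (_∈_ to _∈ₗ_)
open import Data.List.Membership.Propositional.Properties
  using (∈-concat⁺′; ∈-upTo⁺; ∈-map∘filter⁺; ∈-map∘filter⁻) renaming (∈-map⁺ to ∈ₗ-map⁺)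
import Data.List.Relation.Unary.All as ListAll
open import Data.List.Relation.Unary.Any using (here; there)
import Data.List.Relation.Unary.Any as ListAny
open import Data.Nat using (ℕ; zero; suc; _+_; _∸_; _≤_; _<_; _≤ᵇ_; _<ᵇ_; z≤n; s≤s; z<s; _≟_; _≤?_; _<?_)
open import Data.Nat.Properties
open import Data.Product using (Σ; ∃-syntax; _×_; _,_; proj₁; proj₂)
open import Data.Sum using (inj₁; inj₂)
open import Data.Unit using (tt)
open import Data.Vec using (Vec; []; _∷_; map)
open import Data.Vec.Membership.Propositional using (_∈_)
open import Data.Vec.Membership.Propositional.Properties using (∈-map⁺; fromAny)
open import Data.Vec.Relation.Unary.All as All using (All; []; _∷_)
import Data.Vec.Relation.Unary.All.Properties as Allₚ
open import Data.Vec.Relation.Unary.Any using (here; there)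
import Data.Vec.Relation.Unary.Any.Properties as Anyₚ
open import Data.Vec.Relation.Unary.AllPairs as AllPairs using (AllPairs; []; _∷_)
import Data.Vec.Relation.Unary.AllPairs.Properties as AllPairsₚ
open import Data.Vec.Relation.Unary.Unique.Propositional using (Unique)
import Data.Vec.Relation.Unary.Unique.Propositional.Properties as Uniqueₚ
open import Relation.Binary.Definitions using (Symmetric; tri<; tri≈; tri>)
open import Relation.Binary.PropositionalEquality
open import Relation.Nullary using (¬_; Dec; yes; no; does; contradiction)
open import Relation.Nullary.Decidable using (dec-true; decidable-stable; _×-dec_)
open import Relation.Nullary.Reflects using (ofʸ; ofⁿ)

-- Strictly increasing vectors and insertion sort

infix 4 _⊆_

_⊆_ : ∀ {m n} → Vec ℕ m → Vec ℕ n → Set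
xs ⊆ ys = ∀ {x} → x ∈ xs → x ∈ ys

∷⁺-⊆ : ∀ {m n x} {xs : Vec ℕ m} {ys : Vec ℕ n} → xs ⊆ ys → x ∷ xs ⊆ x ∷ ys
∷⁺-⊆ xs⊆ys (here refl) = here refl
∷⁺-⊆ xs⊆ys (there z∈xs) = there (xs⊆ys z∈xs)

All-⊆ : ∀ {P : ℕ → Set} {m n} {xs : Vec ℕ m} {ys : Vec ℕ n} → xs ⊆ ys → All P ys → All P xs
All-⊆ {xs = []} _ _ = []
All-⊆ {xs = x ∷ xs} xs⊆ys pys =
  All.lookup pys (xs⊆ys (here refl)) ∷ All-⊆ (λ z∈xs → xs⊆ys (there z∈xs)) pys

∈-map⁻ : ∀ {f : ℕ → ℕ} {n y} {xs : Vec ℕ n} → y ∈ map f xs → ∃[ x ] x ∈ xs × y ≡ f x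
∈-map⁻ y∈fxs = fromAny (Anyₚ.map⁻ y∈fxs)

map-⊆ : ∀ (f : ℕ → ℕ) {m n} {xs : Vec ℕ m} {ys : Vec ℕ n} → xs ⊆ ys → map f xs ⊆ map f ys
map-⊆ f xs⊆ys y∈fxs with ∈-map⁻ y∈fxs
... | x , x∈xs , refl = ∈-map⁺ f (xs⊆ys x∈xs)

map-⊆⁻ : ∀ (f : ℕ → ℕ) {m n} {xs : Vec ℕ m} {ys : Vec ℕ n} →
         (∀ {x y} → x ∈ xs → y ∈ ys → f x ≡ f y → x ≡ y) →
         map f xs ⊆ map f ys → xs ⊆ ys
map-⊆⁻ f injective fxs⊆fys x∈xs with ∈-map⁻ (fxs⊆fys (∈-map⁺ f x∈xs))
... | y , y∈ys , fx≡fy = subst (_∈ _) (sym (injective x∈xs y∈ys fx≡fy)) y∈ys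

AllPairs-map⁻ : ∀ {R : ℕ → ℕ → Set} {f : ℕ → ℕ} {n} {xs : Vec ℕ n} →
                AllPairs R (map f xs) → AllPairs (λ x y → R (f x) (f y)) xs
AllPairs-map⁻ {xs = []} [] = []
AllPairs-map⁻ {xs = _ ∷ _} (r ∷ rs) = Allₚ.map⁻ r ∷ AllPairs-map⁻ rs

Sorted : ∀ {n} → Vec ℕ n → Set
Sorted = AllPairs _<_

SortedBelow : ∀ {n} → ℕ → Vec ℕ n → Set
SortedBelow M t = Sorted t × All (_< M) t

Incr⇒Sorted : ∀ {n} {s : Vec ℕ n} → Incr s → Sorted s
Incr⇒Sorted {s = []} _ = []
Incr⇒Sorted {s = x ∷ []} _ = [] ∷ []
Incr⇒Sorted {s = x ∷ y ∷ s} (x<y , incr) with Incr⇒Sorted incr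
... | y<s ∷ sorted = (x<y ∷ All.map (λ y<z → <-trans x<y y<z) y<s) ∷ y<s ∷ sorted

Sorted⇒Incr : ∀ {n} {s : Vec ℕ n} → Sorted s → Incr s
Sorted⇒Incr {s = []} _ = tt
Sorted⇒Incr {s = x ∷ []} _ = tt
Sorted⇒Incr {s = x ∷ y ∷ s} ((x<y ∷ _) ∷ sorted) = x<y , Sorted⇒Incr sorted

Sorted⇒Unique : ∀ {n} {s : Vec ℕ n} → Sorted s → Unique s
Sorted⇒Unique = AllPairs.map <⇒≢

⊆-∷-strict : ∀ {m n x} {xs : Vec ℕ m} {ys : Vec ℕ n} → All (x <_) xs → xs ⊆ x ∷ ys → xs ⊆ ys
⊆-∷-strict x<xs xs⊆ z∈xs with xs⊆ z∈xs
... | here refl = contradiction (All.lookup x<xs z∈xs) (<-irrefl refl)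
... | there z∈ys = z∈ys

Sorted-head-≡ : ∀ {m n x y} {xs : Vec ℕ m} {ys : Vec ℕ n} → Sorted (x ∷ xs) → Sorted (y ∷ ys) →
                x ∷ xs ⊆ y ∷ ys → y ∷ ys ⊆ x ∷ xs → x ≡ y
Sorted-head-≡ (x<xs ∷ _) (y<ys ∷ _) xs⊆ys ys⊆xs with xs⊆ys (here refl) | ys⊆xs (here refl)
... | here x≡y | _ = x≡y
... | there _ | here y≡x = sym y≡x
... | there x∈ys | there y∈xs = contradiction (All.lookup x<xs y∈xs) (<-asym (All.lookup y<ys x∈ys))

Sorted-≡ : ∀ {n} {xs ys : Vec ℕ n} → Sorted xs → Sorted ys → xs ⊆ ys → ys ⊆ xs → xs ≡ ys
Sorted-≡ {xs = []} {[]} _ _ _ _ = refl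
Sorted-≡ {xs = x ∷ xs} {y ∷ ys} sxs@(x<xs ∷ sxs′) sys@(y<ys ∷ sys′) xs⊆ys ys⊆xs
  with Sorted-head-≡ sxs sys xs⊆ys ys⊆xs
... | refl = cong (x ∷_) (Sorted-≡ sxs′ sys′ (⊆-∷-strict x<xs (λ z∈ → xs⊆ys (there z∈)))
                                             (⊆-∷-strict y<ys (λ z∈ → ys⊆xs (there z∈))))

ins-⊆ : ∀ {n j} {xs : Vec ℕ n} → ins j xs ⊆ j ∷ xs
ins-⊆ {xs = []} z∈ = z∈
ins-⊆ {j = j} {x ∷ xs} z∈ with j ≤ᵇ x
... | true = z∈
... | false with z∈
...   | here refl = there (here refl)
...   | there z∈ins with ins-⊆ {j = j} z∈ins
...     | here refl = here refl
...     | there z∈xs = there (there z∈xs)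

⊆-ins : ∀ {n j} {xs : Vec ℕ n} → j ∷ xs ⊆ ins j xs
⊆-ins {xs = []} z∈ = z∈
⊆-ins {j = j} {x ∷ xs} z∈ with j ≤ᵇ x
... | true = z∈
... | false with z∈
...   | here refl = there (⊆-ins {xs = xs} (here refl))
...   | there (here refl) = here refl
...   | there (there z∈xs) = there (⊆-ins (there z∈xs))

ins-above : ∀ {n j x} {xs : Vec ℕ n} → x < j → ins j (x ∷ xs) ≡ x ∷ ins j xs
ins-above {j = j} {x} x<j with j ≤ᵇ x | ≤ᵇ-reflects-≤ j x
... | true | ofʸ j≤x = contradiction j≤x (<⇒≱ x<j)
... | false | _ = refl

ins-sorted : ∀ {n j} {xs : Vec ℕ n} → Sorted xs → All (j ≢_) xs → Sorted (ins j xs)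
ins-sorted {xs = []} [] [] = [] ∷ []
ins-sorted {j = j} {x ∷ xs} (x<xs ∷ sxs) (j≢x ∷ j∉xs) with j ≤ᵇ x | ≤ᵇ-reflects-≤ j x
... | true | ofʸ j≤x = (j<x ∷ All.map (λ x<y → <-trans j<x x<y) x<xs) ∷ x<xs ∷ sxs
  where j<x = ≤∧≢⇒< j≤x j≢x
... | false | ofⁿ j≰x = All-⊆ ins-⊆ (≰⇒> j≰x ∷ x<xs) ∷ ins-sorted sxs j∉xs

ins-AllPairs : ∀ {R : ℕ → ℕ → Set} → Symmetric R → ∀ {n j} {xs : Vec ℕ n} →
               All (R j) xs → AllPairs R xs → AllPairs R (ins j xs)
ins-AllPairs sym {xs = []} [] [] = [] ∷ []
ins-AllPairs sym {j = j} {x ∷ xs} (Rjx ∷ Rjxs) (Rxxs ∷ pxs) with j ≤ᵇ x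
... | true = (Rjx ∷ Rjxs) ∷ Rxxs ∷ pxs
... | false = All-⊆ ins-⊆ (sym Rjx ∷ Rxxs) ∷ ins-AllPairs sym Rjxs pxs

sort : ∀ {n} → Vec ℕ n → Vec ℕ n
sort [] = []
sort (x ∷ xs) = ins x (sort xs)

sort-⊆ : ∀ {n} {xs : Vec ℕ n} → sort xs ⊆ xs
sort-⊆ {xs = []} ()
sort-⊆ {xs = x ∷ xs} z∈ = ∷⁺-⊆ sort-⊆ (ins-⊆ z∈)

⊆-sort : ∀ {n} {xs : Vec ℕ n} → xs ⊆ sort xs
⊆-sort {xs = x ∷ xs} z∈ = ⊆-ins (∷⁺-⊆ ⊆-sort z∈)

sort-sorted : ∀ {n} {xs : Vec ℕ n} → Unique xs → Sorted (sort xs)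
sort-sorted {xs = []} [] = []
sort-sorted {xs = x ∷ xs} (x∉xs ∷ u) = ins-sorted (sort-sorted u) (All-⊆ sort-⊆ x∉xs)

sort-AllPairs : ∀ {R : ℕ → ℕ → Set} → Symmetric R → ∀ {n} {xs : Vec ℕ n} →
                AllPairs R xs → AllPairs R (sort xs)
sort-AllPairs sym [] = []
sort-AllPairs sym (Rxxs ∷ pxs) = ins-AllPairs sym (All-⊆ sort-⊆ Rxxs) (sort-AllPairs sym pxs)

split-max : ∀ {n} (s : Vec ℕ (suc n)) → Incr s →
            Σ ℕ λ M → Σ (Vec ℕ n) λ t → SortedBelow M t × s ≡ ins M t
split-max (x ∷ []) _ = x , [] , ([] , []) , refl
split-max (x ∷ y ∷ s) (x<y , incr) with split-max (y ∷ s) incr | Incr⇒Sorted (x<y , incr)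
... | M , t , (st , t<M) , s≡ | x<ys ∷ _ =
  M , x ∷ t , (All-⊆ (λ z∈ → ⊆-ins (there z∈)) x<Mt ∷ st , x<M ∷ t<M) ,
  trans (cong (x ∷_) s≡) (sym (ins-above x<M))
  where
  x<Mt : All (x <_) (ins M t)
  x<Mt = subst (All (x <_)) s≡ x<ys
  x<M : x < M
  x<M = All.lookup x<Mt (⊆-ins {xs = t} (here refl))

sorted-head-bound : ∀ {n M x} {xs : Vec ℕ n} → Sorted (x ∷ xs) → All (_< M) (x ∷ xs) → n + x < M
sorted-head-bound {xs = []} _ (x<M ∷ []) = x<M
sorted-head-bound {suc n} {x = x} {y ∷ xs} ((x<y ∷ _) ∷ sorted) (_ ∷ bounded) =
  ≤-<-trans (≤-trans (≤-reflexive (sym (+-suc n x))) (+-monoʳ-≤ n x<y))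
            (sorted-head-bound sorted bounded)

sorted-length : ∀ {n M} {xs : Vec ℕ n} → SortedBelow M xs → n ≤ M
sorted-length {xs = []} _ = z≤n
sorted-length {suc n} {xs = x ∷ xs} (sorted , bounded) =
  ≤-trans (s≤s (m≤m+n n x)) (sorted-head-bound sorted bounded)

range : ℕ → (n : ℕ) → Vec ℕ n
range a zero = []
range a (suc n) = a ∷ range (suc a) n

range-bounds : ∀ a n → All (λ x → a ≤ x × x < a + n) (range a n)
range-bounds a zero = []
range-bounds a (suc n) =
  (≤-refl , m<m+n a z<s) ∷
  All.map (λ { {x} (a<x , x<) → <⇒≤ a<x , subst (x <_) (sym (+-suc a n)) x< }) (range-bounds (suc a) n)

range-sorted : ∀ a n → Sorted (range a n)
range-sorted a zero = []
range-sorted a (suc n) = All.map proj₁ (range-bounds (suc a) n) ∷ range-sorted (suc a) n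

∈-range : ∀ {a i} n → a ≤ i → i < a + n → i ∈ range a n
∈-range {a} {i} zero a≤i i<a+0 = contradiction (subst (i <_) (+-identityʳ a) i<a+0) (≤⇒≯ a≤i)
∈-range {a} {i} (suc n) a≤i i<a+1+n with a ≟ i
... | yes refl = here refl
... | no a≢i = there (∈-range n (≤∧≢⇒< a≤i a≢i) (subst (i <_) (+-suc a n) i<a+1+n))

window : ∀ {a i M} n → a ≤ i → i < a + n → a + n ≤ M →
         Σ (Vec ℕ n) λ t → SortedBelow M t × i ∈ t
window {a} n a≤i i<a+n a+n≤M =
  range a n ,
  (range-sorted a n , All.map (λ { (_ , x<a+n) → <-≤-trans x<a+n a+n≤M }) (range-bounds a n)) ,
  ∈-range n a≤i i<a+n

sortedBelow-containing : ∀ {M i} n → suc n ≤ M → i < M →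
                         Σ (Vec ℕ (suc n)) λ t → SortedBelow M t × i ∈ t
sortedBelow-containing {M} {i} n m≤M i<M with i + suc n ≤? M
... | yes i+m≤M = window (suc n) ≤-refl (m<m+n i z<s) i+m≤M
... | no i+m≰M = window (suc n) a≤i (subst (i <_) (sym a+m≡M) i<M) (≤-reflexive a+m≡M)
  where
  a+m≡M : M ∸ suc n + suc n ≡ M
  a+m≡M = m∸n+n≡m m≤M
  a≤i : M ∸ suc n ≤ i
  a≤i = subst (M ∸ suc n ≤_) (m+n∸n≡m i (suc n)) (∸-monoˡ-≤ (suc n) (<⇒≤ (≰⇒> i+m≰M)))

vecsBelow : ℕ → (n : ℕ) → List (Vec ℕ n)
vecsBelow M zero = [] ∷ []
vecsBelow M (suc n) = concatMap (λ x → mapₗ (x ∷_) (vecsBelow M n)) (upTo M)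

∈-vecsBelow : ∀ {M n} {t : Vec ℕ n} → All (_< M) t → t ∈ₗ vecsBelow M n
∈-vecsBelow [] = here refl
∈-vecsBelow {M} {suc n} {x ∷ t} (x<M ∷ t<M) =
  ∈-concat⁺′ (∈ₗ-map⁺ (x ∷_) (∈-vecsBelow t<M))
             (∈ₗ-map⁺ (λ y → mapₗ (y ∷_) (vecsBelow M n)) (∈-upTo⁺ x<M))

-- Pulling colourings back and forth

-- Where g is not injective on s, R is read at a non-increasing (junk)
-- argument; only sets on which g is injective matter.
pullback : ∀ {n k} → (ℕ → ℕ) → (Vec ℕ n → Fin k) → Vec ℕ n → Fin k
pullback g R s = R (sort (map g s))

preimages : ∀ {n} {g : ℕ → ℕ} {A : Sub} {s : Vec ℕ n} →
            All (λ y → ∃[ x ] x ∈ω A × g x ≡ y) s → ∃[ xs ] All (_∈ω A) xs × map g xs ≡ s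
preimages [] = [] , [] , refl
preimages ((x , x∈A , refl) ∷ ps) with preimages ps
... | xs , xs⊆A , refl = x ∷ xs , x∈A ∷ xs⊆A , refl

module _ (em : ExcludedMiddle 0ℓ) where

  image : (ℕ → ℕ) → Sub → Sub
  image g A y = does (em {∃[ x ] x ∈ω A × g x ≡ y})

  ∈-image⁺ : ∀ {g A x} → x ∈ω A → g x ∈ω image g A
  ∈-image⁺ x∈A = dec-true em (_ , x∈A , refl)

  ∈-image⁻ : ∀ {g A y} → y ∈ω image g A → ∃[ x ] x ∈ω A × g x ≡ y
  ∈-image⁻ {g} {A} {y} y∈gA with em {∃[ x ] x ∈ω A × g x ≡ y}
  ... | yes preimage = preimage
  ∈-image⁻ () | no _

  image-homogeneous : ∀ {n k l} {R : Vec ℕ n → Fin k} {g A} →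
                      ImageAtMost (pullback g R) A l → ImageAtMost R (image g A) l
  image-homogeneous {R = R} {g} {A} (S , ∣S∣≤l , homogeneous) =
    S , ∣S∣≤l , λ s (incr , s⊆gA) → colour∈S incr (preimages (All.map ∈-image⁻ s⊆gA))
    where
    colour∈S : ∀ {s} → Incr s → ∃[ xs ] All (_∈ω A) xs × map g xs ≡ s → R s ∈ₛ S
    colour∈S incr (xs , xs⊆A , refl) =
      subst (λ v → R v ∈ₛ S) (Sorted-≡ sorted (Incr⇒Sorted incr) sort⊆ ⊆sort)
            (homogeneous (sort xs) (Sorted⇒Incr (sort-sorted xs-unique) , All-⊆ sort-⊆ xs⊆A))
      where
      g-distinct : AllPairs (λ a b → g a ≢ g b) xs
      g-distinct = AllPairs-map⁻ (Sorted⇒Unique (Incr⇒Sorted incr))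
      xs-unique : Unique xs
      xs-unique = AllPairs.map (λ ga≢gb a≡b → ga≢gb (cong g a≡b)) g-distinct
      sorted : Sorted (sort (map g (sort xs)))
      sorted = sort-sorted (AllPairsₚ.map⁺ (sort-AllPairs (λ ne e → ne (sym e)) g-distinct))
      sort⊆ : sort (map g (sort xs)) ⊆ map g xs
      sort⊆ y∈ = map-⊆ g sort-⊆ (sort-⊆ y∈)
      ⊆sort : map g xs ⊆ sort (map g (sort xs))
      ⊆sort y∈ = ⊆-sort (map-⊆ g ⊆-sort y∈)

Katětov⇒¬Arrow : ExcludedMiddle 0ℓ → ∀ {n k l} {R : Vec ℕ n → Fin k} {I} → IsIdeal I →
                 RIdeal n k l R ≤K I → ¬ Arrow I n k l
Katětov⇒¬Arrow em {R = R} idl (g , g-Katětov) arrow with arrow (pullback g R)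
... | A , A∉I , homogeneous =
  A∉I (downward A (preimage g gA) (λ _ → ∈-image⁺ em) (g-Katětov gA gA∈ℛ))
  where
  open IsIdeal idl
  gA = image em g A
  gA∈ℛ : RIdeal _ _ _ R gA
  gA∈ℛ = gA ∷ [] , image-homogeneous em homogeneous ListAll.∷ ListAll.[] , λ _ → here

⋃ : List Sub → Sub
⋃ [] _ = false
⋃ (B ∷ Bs) = B ∪ω ⋃ Bs

∈-⋃ : ∀ {x Bs} → ListAny.Any (x ∈ω_) Bs → x ∈ω ⋃ Bs
∈-⋃ {Bs = B ∷ Bs} (here x∈B) rewrite x∈B = refl
∈-⋃ {x} {B ∷ Bs} (there x∈⋃) with B x
... | true = refl
... | false = ∈-⋃ x∈⋃

≤K-via-generators : ∀ {n k l} {R : Vec ℕ n → Fin k} {I} (f : ℕ → ℕ) → IsIdeal I →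
                    (∀ B → ImageAtMost R B l → I (preimage f B)) → RIdeal n k l R ≤K I
≤K-via-generators {R = R} {I} f idl generators⊆ =
  f , λ A (Bs , homogeneous , A⊆⋃) →
    downward _ _ (λ x x∈A → ∈-⋃ (A⊆⋃ (f x) x∈A)) (preimage-⋃ Bs homogeneous)
  where
  open IsIdeal idl
  preimage-⋃ : ∀ Bs → ListAll.All (λ B → ImageAtMost R B _) Bs → I (preimage f (⋃ Bs))
  preimage-⋃ [] ListAll.[] = finite _ (0 , λ _ ())
  preimage-⋃ (B ∷ Bs) (hB ListAll.∷ hBs) = union _ _ (generators⊆ B hB) (preimage-⋃ Bs hBs)

¬Arrow⇒colouring : ExcludedMiddle 0ℓ → ∀ {n k l I} → ¬ Arrow I n k l →
                   ∃[ c ] (∀ A → ImageAtMost c A l → I A)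
¬Arrow⇒colouring em {n} {k} {l} {I} ¬arrow with em {∃[ c ] (∀ A → ImageAtMost c A l → I A)}
... | yes bad = bad
... | no ¬bad = ⊥-elim (¬arrow arrow)
  where
  arrow : Arrow I n k l
  arrow c with em {∃[ A ] ¬ I A × ImageAtMost c A l}
  ... | yes good = good
  ... | no ¬good = ⊥-elim (¬bad (c , λ A hom → decidable-stable em (λ A∉I → ¬good (A , A∉I , hom))))

preimage-homogeneous : ∀ {n k l} {R c : Vec ℕ n → Fin k} {f : ℕ → ℕ} {B} →
                       (∀ {x y} → f x ≡ f y → x ≡ y) → (∀ s → Incr s → c s ≡ R (sort (map f s))) →
                       ImageAtMost R B l → ImageAtMost c (preimage f B) l
preimage-homogeneous {R = R} {c} {f} injective transfer (S , ∣S∣≤l , homogeneous) =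
  S , ∣S∣≤l , λ s (incr , s⊆f⁻¹B) →
    subst (_∈ₛ S) (sym (transfer s incr))
      (homogeneous (sort (map f s))
        (Sorted⇒Incr (sort-sorted (Uniqueₚ.map⁺ injective (Sorted⇒Unique (Incr⇒Sorted incr)))) ,
         All-⊆ sort-⊆ (Allₚ.map⁺ s⊆f⁻¹B)))

-- Embedding a colouring into R

module _ {m k} (R : Vec ℕ (suc m) → Fin k) where

  StarConsistent : List (Vec ℕ m × Fin k) → Set
  StarConsistent L =
    ListAll.All (λ q → Incr (proj₁ q)) L ×
    (∀ q q′ → q ∈ₗ L → q′ ∈ₗ L → proj₁ q ≡ proj₁ q′ → proj₂ q ≡ proj₂ q′)

  Realises : ℕ → List (Vec ℕ m × Fin k) → Set
  Realises j L = ListAll.All (λ q → All (j ≢_) (proj₁ q)) L ×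
                 ListAll.All (λ q → R (ins j (proj₁ q)) ≡ proj₂ q) L

  -- 0 is a junk value for inconsistent lists.
  starWitness : ExcludedMiddle 0ℓ → StarProperty (suc m) k R → List (Vec ℕ m × Fin k) → ℕ
  starWitness em star L with em {StarConsistent L}
  ... | yes (incr , disjoint) = proj₁ (star L incr disjoint)
  ... | no _ = 0

  starWitness-realises : ∀ (em : ExcludedMiddle 0ℓ) (star : StarProperty (suc m) k R) L →
                         StarConsistent L → Realises (starWitness em star L) L
  starWitness-realises em star L consistent with em {StarConsistent L}
  ... | yes (incr , disjoint) = proj₂ (star L incr disjoint)
  ... | no inconsistent = contradiction consistent inconsistent

sortedBelow? : ∀ {n} M (t : Vec ℕ n) → Dec (SortedBelow M t)
sortedBelow? M t = AllPairs.allPairs? _<?_ t ×-dec All.all? (_<? M) t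

module Embedding (em : ExcludedMiddle 0ℓ) {p k} (R : Vec ℕ (suc (suc p)) → Fin k)
                 (star : StarProperty (suc (suc p)) k R) (c : Vec ℕ (suc (suc p)) → Fin k) where

  constraint : (ℕ → ℕ) → ℕ → Vec ℕ (suc p) → Vec ℕ (suc p) × Fin k
  constraint h M t = sort (map h t) , c (ins M t)

  constraints : (ℕ → ℕ) → ℕ → List (Vec ℕ (suc p) × Fin k)
  constraints h M = mapₗ (constraint h M) (filter (sortedBelow? M) (vecsBelow M (suc p)))

  -- F M is f on [0, M) (and junk 0 elsewhere): all that f M depends on.
  -- For M < n − 1 no (n − 1)-subset of M is to be realised, so f M = M is
  -- merely a fresh value.
  F : ℕ → ℕ → ℕ
  f : ℕ → ℕ
  F zero x = 0
  F (suc M) x = if x <ᵇ M then F M x else f M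
  f M = if M <ᵇ suc p then M else starWitness R em star (constraints (F M) M)

  F-agrees : ∀ {M x} → x < M → F M x ≡ f x
  F-agrees {suc M} {x} x<1+M with x <ᵇ M | <ᵇ-reflects-< x M
  ... | true | ofʸ x<M = F-agrees x<M
  ... | false | ofⁿ x≮M = cong f (sym (≤-antisym (m<1+n⇒m≤n x<1+M) (≮⇒≥ x≮M)))

  map-F : ∀ {M n} {t : Vec ℕ n} → All (_< M) t → map (F M) t ≡ map f t
  map-F [] = refl
  map-F (x<M ∷ t<M) = cong₂ _∷_ (F-agrees x<M) (map-F t<M)

  f-small : ∀ {M} → M < suc p → f M ≡ M
  f-small {M} M<m with M <ᵇ suc p | <ᵇ-reflects-< M (suc p)
  ... | true | _ = refl
  ... | false | ofⁿ M≮m = contradiction M<m M≮m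

  f-large : ∀ {M} → suc p ≤ M → f M ≡ starWitness R em star (constraints (F M) M)
  f-large {M} m≤M with M <ᵇ suc p | <ᵇ-reflects-< M (suc p)
  ... | true | ofʸ M<m = contradiction m≤M (<⇒≱ M<m)
  ... | false | _ = refl

  ∈-constraints⁺ : ∀ {h M t} → SortedBelow M t → constraint h M t ∈ₗ constraints h M
  ∈-constraints⁺ {h} {M} {t} below =
    ∈-map∘filter⁺ (constraint h M) (sortedBelow? M) {xs = vecsBelow M (suc p)}
                  (t , ∈-vecsBelow (proj₂ below) , refl , below)

  ∈-constraints⁻ : ∀ {h M q} → q ∈ₗ constraints h M → ∃[ t ] SortedBelow M t × q ≡ constraint h M t
  ∈-constraints⁻ {h} {M} q∈
    with ∈-map∘filter⁻ (constraint h M) (sortedBelow? M) {xs = vecsBelow M (suc p)} q∈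
  ... | t , _ , q≡ , below = t , below , q≡

  InjectiveBelow : ℕ → Set
  InjectiveBelow M = ∀ {i j} → i < j → j < M → f i ≢ f j

  injectiveOn : ∀ {M} → InjectiveBelow M → ∀ {i j} → i < M → j < M → f i ≡ f j → i ≡ j
  injectiveOn injective {i} {j} i<M j<M fi≡fj with <-cmp i j
  ... | tri< i<j _ _ = contradiction fi≡fj (injective i<j j<M)
  ... | tri≈ _ i≡j _ = i≡j
  ... | tri> _ _ j<i = contradiction (sym fi≡fj) (injective j<i i<M)

  distinct-below : ∀ {M n} {t : Vec ℕ n} → InjectiveBelow M → SortedBelow M t →
                   AllPairs (λ a b → f a ≢ f b) t
  distinct-below injective ([] , []) = []
  distinct-below injective (x<t ∷ st , x<M ∷ t<M) =
    All.map (λ { (x<y , y<M) → injective x<y y<M }) (All.zip (x<t , t<M)) ∷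
    distinct-below injective (st , t<M)

  sort-map-⊆ : ∀ {M n} {t t′ : Vec ℕ n} → InjectiveBelow M → All (_< M) t → All (_< M) t′ →
               sort (map f t) ≡ sort (map f t′) → t ⊆ t′
  sort-map-⊆ injective t<M t′<M ft≡ft′ =
    map-⊆⁻ f (λ x∈ y∈ → injectiveOn injective (All.lookup t<M x∈) (All.lookup t′<M y∈))
             (λ y∈ → sort-⊆ (subst (_ ∈_) ft≡ft′ (⊆-sort y∈)))

  consistent : ∀ {M} → InjectiveBelow M → StarConsistent R (constraints (F M) M)
  consistent {M} injective = ListAll.tabulate incr , disjoint
    where
    incr : ∀ {q} → q ∈ₗ constraints (F M) M → Incr (proj₁ q)
    incr q∈ with ∈-constraints⁻ q∈
    ... | t , below , refl rewrite map-F (proj₂ below) =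
      Sorted⇒Incr (sort-sorted (AllPairsₚ.map⁺ (distinct-below injective below)))
    disjoint : ∀ q q′ → q ∈ₗ constraints (F M) M → q′ ∈ₗ constraints (F M) M →
               proj₁ q ≡ proj₁ q′ → proj₂ q ≡ proj₂ q′
    disjoint q q′ q∈ q′∈ Ft≡Ft′ with ∈-constraints⁻ q∈ | ∈-constraints⁻ q′∈
    ... | t , (st , t<M) , refl | t′ , (st′ , t′<M) , refl =
      cong (λ u → c (ins M u)) (Sorted-≡ st st′ (sort-map-⊆ injective t<M t′<M ft≡ft′)
                                                 (sort-map-⊆ injective t′<M t<M (sym ft≡ft′)))
      where
      ft≡ft′ : sort (map f t) ≡ sort (map f t′)
      ft≡ft′ = subst₂ (λ u v → sort u ≡ sort v) (map-F t<M) (map-F t′<M) Ft≡Ft′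

  stage : ∀ {M} {t : Vec ℕ (suc p)} → suc p ≤ M → InjectiveBelow M → SortedBelow M t →
          All (f M ≢_) (sort (map f t)) × R (ins (f M) (sort (map f t))) ≡ c (ins M t)
  stage {M} {t} m≤M injective below =
    subst₂ (λ j u → All (j ≢_) (sort u) × R (ins j (sort u)) ≡ c (ins M t))
           (sym (f-large m≤M)) (map-F (proj₂ below))
           (ListAll.lookup avoids t∈ , ListAll.lookup colours t∈)
    where
    t∈ = ∈-constraints⁺ below
    realised = starWitness-realises R em star (constraints (F M) M) (consistent injective)
    avoids = proj₁ realised
    colours = proj₂ realised

  fresh : ∀ {M} → InjectiveBelow M → ∀ {i} → i < M → f i ≢ f M
  fresh {M} injective {i} i<M with M <? suc p
  ... | yes M<m = λ fi≡fM →
    <-irrefl (trans (sym (f-small (<-trans i<M M<m))) (trans fi≡fM (f-small M<m))) i<M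
  ... | no M≮m with sortedBelow-containing p (≮⇒≥ M≮m) i<M
  ...   | t , below , i∈t = λ fi≡fM →
    All.lookup (proj₁ (stage (≮⇒≥ M≮m) injective below)) (⊆-sort (∈-map⁺ f i∈t)) (sym fi≡fM)

  injective-below : ∀ M → InjectiveBelow M
  injective-below (suc M) i<j j<1+M with m<1+n⇒m<n∨m≡n j<1+M
  ... | inj₁ j<M = injective-below M i<j j<M
  ... | inj₂ refl = fresh (injective-below M) i<j

  injective : ∀ {x y} → f x ≡ f y → x ≡ y
  injective {x} {y} = injectiveOn (injective-below (suc (x + y))) (s≤s (m≤m+n x y)) (s≤s (m≤n+m y x))

  transfer : ∀ s → Incr s → c s ≡ R (sort (map f s))
  transfer s incr with split-max s incr
  ... | M , t , below@(st , _) , refl = begin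
    c (ins M t)                     ≡⟨ sym (proj₂ stage-M) ⟩
    R (ins (f M) (sort (map f t)))  ≡⟨ cong R (Sorted-≡ inserted-sorted sorted inserted⊆ ⊆inserted) ⟩
    R (sort (map f (ins M t)))      ∎
    where
    open ≡-Reasoning
    stage-M = stage (sorted-length below) (injective-below M) below
    inserted-sorted : Sorted (ins (f M) (sort (map f t)))
    inserted-sorted =
      ins-sorted (sort-sorted (Uniqueₚ.map⁺ injective (Sorted⇒Unique st))) (proj₁ stage-M)
    sorted : Sorted (sort (map f (ins M t)))
    sorted = sort-sorted (Uniqueₚ.map⁺ injective (Sorted⇒Unique (Incr⇒Sorted incr)))
    inserted⊆ : ins (f M) (sort (map f t)) ⊆ sort (map f (ins M t))
    inserted⊆ y∈ = ⊆-sort (map-⊆ f (⊆-ins {j = M} {t}) (∷⁺-⊆ sort-⊆ (ins-⊆ y∈)))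
    ⊆inserted : sort (map f (ins M t)) ⊆ ins (f M) (sort (map f t))
    ⊆inserted y∈ = ⊆-ins (∷⁺-⊆ ⊆-sort (map-⊆ f (ins-⊆ {j = M} {t}) (sort-⊆ y∈)))

¬Arrow⇒Katětov : ExcludedMiddle 0ℓ → ∀ {p k l} {R : Vec ℕ (suc (suc p)) → Fin k} →
                 StarProperty (suc (suc p)) k R → ∀ {I} → IsIdeal I →
                 ¬ Arrow I (suc (suc p)) k l → RIdeal (suc (suc p)) k l R ≤K I
¬Arrow⇒Katětov em {R = R} star idl ¬arrow with ¬Arrow⇒colouring em ¬arrow
... | c , homogeneous⇒I =
  ≤K-via-generators f idl (λ B hom → homogeneous⇒I _ (preimage-homogeneous injective transfer hom))
  where open Embedding em R star c

proposition2p4 : ExcludedMiddle 0ℓ →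
    ∀ (n k l : ℕ) → 2 ≤ n → l < k →
    (R : Vec ℕ n → Fin k) → StarProperty n k R →
    (I : Sub → Set) → IsIdeal I →
    ((RIdeal n k l R ≤K I → ¬ Arrow I n k l) × (¬ Arrow I n k l → RIdeal n k l R ≤K I))
proposition2p4 em (suc (suc p)) k l _ _ R star I idl =
  Katětov⇒¬Arrow em idl , ¬Arrow⇒Katětov em star idl
proposition2p4 em (suc zero) k l (s≤s ()) _ R star I idl
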